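{- For every integer $r\ge 3$, $m(r)\ge (r-1)^{r-1}$; that is, every minimal uncolorable $r$-uniform bi-hypergraph has at least $(r-1)^{r-1}$ edges.
   Context: A bi-hypergraph is a pair $\mathcal{H}=(\mathcal{V},\mathcal{E})$ with $\mathcal{V}$ a finite set and $\mathcal{E}$ a Sperner family of subsets of $\mathcal{V}$ (edges); it is $r$-uniform if all edges have size $r$. A proper coloring is a map $f:\mathcal{V}\to\mathbb{N}$ with $1<|\{f(v):v\in e\}|<|e|$ for every edge $e$; $\mathcal{H}$ is colorable if such $f$ exists, and uncolorable otherwise. A subhypergraph of $\mathcal{H}$ is a bi-hypergraph $(\mathcal{V}',\mathcal{E}')$ with $\mathcal{V}'\subseteq\mathcal{V}$, $\mathcal{E}'\subseteq\mathcal{E}$. $\mathcal{H}$ is minimal uncolorable if it is uncolorable but every proper subhypergraph is colorable. $m(r)$ denotes the smallest positive integer $m$ such that there exists a minimal uncolorable $r$-uniform bi-hypergraph with $m$ edges. -}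

module Defs where

open import Data.Nat using (ℕ; _<_)
open import Data.Nat.Properties using (_≟_)
open import Data.Fin using (Fin)
open import Data.Fin.Subset using (Subset; _∈_; _∉_; _⊆_; ∣_∣)
open import Data.Fin.Subset.Properties using (_∈?_)
open import Data.List using (List; length; filter; map; deduplicate; allFin)
open import Data.List.Relation.Unary.All using (All)
open import Data.List.Relation.Unary.Unique.Propositional using (Unique)
import Data.List.Membership.Propositional as LM
open import Data.Product using (Σ; _×_)
open import Data.Sum using (_⊎_)
open import Relation.Binary.PropositionalEquality using (_≡_)
open import Relation.Nullary using (¬_)

-- A hypergraph on the vertex set V = Fin n, with edge family given as a
-- duplicate-free list of subsets of Fin n (so  length E  = number of edges).

Sperner : ∀ {n} → List (Subset n) → Set
Sperner E = ∀ {e e′} → e LM.∈ E → e′ LM.∈ E → e ⊆ e′ → e ≡ e′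

IsBiHypergraph : ∀ {n} → List (Subset n) → Set
IsBiHypergraph E = Unique E × Sperner E

Uniform : ∀ {n} → ℕ → List (Subset n) → Set
Uniform r E = All (λ e → ∣ e ∣ ≡ r) E

verticesOf : ∀ {n} → Subset n → List (Fin n)
verticesOf e = filter (_∈? e) (allFin _)

numColors : ∀ {n} → (Fin n → ℕ) → Subset n → ℕ
numColors f e = length (deduplicate _≟_ (map f (verticesOf e)))

ProperColoring : ∀ {n} → List (Subset n) → (Fin n → ℕ) → Set
ProperColoring E f = All (λ e → 1 < numColors f e × numColors f e < ∣ e ∣) E

Colorable : ∀ {n} → List (Subset n) → Set
Colorable E = Σ (Fin _ → ℕ) (ProperColoring E)

Uncolorable : ∀ {n} → List (Subset n) → Set
Uncolorable E = ¬ Colorable E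

IsSubhypergraph : ∀ {n} → List (Subset n) → Subset n → List (Subset n) → Set
IsSubhypergraph E V′ E′ = (∀ {e} → e LM.∈ E′ → e LM.∈ E) × All (λ e → e ⊆ V′) E′

IsProperSub : ∀ {n} → List (Subset n) → Subset n → List (Subset n) → Set
IsProperSub {n} E V′ E′ = Σ (Fin n) (λ v → v ∉ V′) ⊎ Σ (Subset n) (λ e → e LM.∈ E × ¬ (e LM.∈ E′))

-- Colorability of the subhypergraph (V′ , E′): a coloring of V′ proper on E′.
-- Colors outside V′ are irrelevant (edges of E′ lie in V′), so we quantify
-- over maps Fin n → ℕ.
MinimalUncolorable : ∀ {n} → List (Subset n) → Set
MinimalUncolorable {n} E =
  Uncolorable E ×
  (∀ (V′ : Subset n) (E′ : List (Subset n)) →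
     IsSubhypergraph E V′ E′ → IsProperSub E V′ E′ → Colorable E′)

-- With k = r − 1 colours no edge of size r is rainbow, so a k-colouring is
-- proper as soon as no edge is monochromatic.  An edge e is monochromatic in a
-- given colour under k ^ (n − r) of the k ^ n colourings, hence if
-- |E| · k · k ^ (n − r) < k ^ n, i.e. |E| < k ^ (r − 1), some colouring has no
-- monochromatic edge.  The method of conditional expectations makes this
-- constructive: colour the vertices one at a time, always choosing a colour
-- for which the weighted number of still-possible monochromatic events stays
-- below the number of remaining colourings.
module Submission where

open import Defs
open import Data.Nat using (ℕ; _≤_; _∸_; _^_)
open import Data.Fin.Subset using (Subset)
open import Data.List using (List; length)

open import Data.Nat.Properties
open import Algebra.Properties.CommutativeSemigroup *-commutativeSemigroup
  using (x∙yz≈y∙xz)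
open import Algebra.Properties.CommutativeMonoid.Sum +-0-commutativeMonoid
  using (sum-syntax; sum-cong-≗; ∑-distrib-+)
open import Data.Bool.Base using (true; false; if_then_else_)
open import Data.Empty using (⊥-elim)
open import Data.Fin as Fin using (Fin; zero; suc; toℕ; fromℕ<)
open import Data.Fin.Properties as Finₚ using (toℕ<n; toℕ-injective; fromℕ<-injective)
open import Data.Fin.Subset using (_∈_; ∣_∣; inside; outside; Nonempty)
open import Data.Fin.Subset.Properties using (_∈?_; nonempty?; Empty-unique; ∣⊥∣≡0)
open import Data.List using ([]; _∷_; [_]; _++_; map; concatMap; allFin; deduplicate; lookup)
open import Data.List.Membership.Propositional using () renaming (_∈_ to _∈ˡ_)
open import Data.List.Membership.Propositional.Properties
  using (∈-lookup; ∈-allFin; ∈-map⁺; ∈-map⁻; ∈-filter⁺; ∈-deduplicate⁺; ∈-deduplicate⁻)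
open import Data.List.Properties using (map-++; length-tabulate)
open import Data.List.Relation.Unary.All as All using (All; []; _∷_)
open import Data.List.Relation.Unary.All.Properties using (concat⁻; map⁻)
open import Data.List.Relation.Unary.AllPairs using (_∷_)
open import Data.List.Relation.Unary.Any using (here; there)
open import Data.List.Relation.Unary.Unique.DecPropositional.Properties using (deduplicate-!)
open import Data.List.Relation.Unary.Unique.Propositional using (Unique)
open import Data.Nat using (zero; suc; _<_; _+_; _*_; s≤s; z≤n; NonZero)
open import Data.Nat.ListAction using (sum)
open import Data.Nat.ListAction.Properties using (sum-++)
open import Data.Product using (_×_; _,_; proj₁; ∃)
open import Data.Vec.Base using ([]; _∷_; here; there)
open import Data.Vec.Functional as Vector using (Vector)
open import Function using (_∘_; id)
open import Relation.Nullary using (¬_; ¬?; yes; no; does; _×-dec_; contradiction)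
open import Relation.Nullary.Decidable using (decidable-stable)
open import Relation.Binary.PropositionalEquality hiding ([_])
open ≡-Reasoning

∑-const : ∀ k x → ∑[ i < k ] x ≡ k * x
∑-const zero    x = refl
∑-const (suc k) x = cong (x +_) (∑-const k x)

∑-indicator : ∀ {k} (c : Fin k) x → ∑[ a < k ] (if does (c Fin.≟ a) then x else 0) ≡ x
∑-indicator {suc k} zero x = begin
  x + ∑[ a < k ] 0 ≡⟨ cong (x +_) (trans (∑-const k 0) (*-zeroʳ k)) ⟩
  x + 0            ≡⟨ +-identityʳ x ⟩
  x                ∎
∑-indicator {suc k} (suc c) x = ∑-indicator c x

∑<*⇒∃< : ∀ {k} (f : Vector ℕ k) B → ∑[ a < k ] f a < k * B → ∃ λ a → f a < B
∑<*⇒∃< {suc k} f B ∑f<kB with f zero <? B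
... | yes f₀<B = zero , f₀<B
... | no  f₀≮B =
  let ∑f∘suc<kB = +-cancelˡ-< B _ _ (≤-<-trans (+-monoˡ-≤ _ (≮⇒≥ f₀≮B)) ∑f<kB)
      a , fa<B  = ∑<*⇒∃< (f ∘ suc) B ∑f∘suc<kB
  in suc a , fa<B

module MonochromaticAvoidance (k : ℕ) where

  Event : ℕ → Set
  Event n = Subset n × Fin k

  Occurs : ∀ {n} → Vector (Fin k) n → Event n → Set
  Occurs g (U , c) = ∀ v → v ∈ U → g v ≡ c

  -- weight U = k ^ (n ∸ ∣ U ∣), the number of colourings under which an
  -- event (U , c) occurs.
  weight : ∀ {n} → Subset n → ℕ
  weight []            = 1
  weight (inside  ∷ U) = weight U
  weight (outside ∷ U) = k * weight U

  k^∣U∣*weight≡k^n : ∀ {n} (U : Subset n) → k ^ ∣ U ∣ * weight U ≡ k ^ n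
  k^∣U∣*weight≡k^n []            = refl
  k^∣U∣*weight≡k^n (inside  ∷ U) = trans (*-assoc k _ _) (cong (k *_) (k^∣U∣*weight≡k^n U))
  k^∣U∣*weight≡k^n {suc n} (outside ∷ U) = begin
    k ^ ∣ U ∣ * (k * weight U) ≡⟨ x∙yz≈y∙xz (k ^ ∣ U ∣) k (weight U) ⟩
    k * (k ^ ∣ U ∣ * weight U) ≡⟨ cong (k *_) (k^∣U∣*weight≡k^n U) ⟩
    k * k ^ n                  ∎

  totalWeight : ∀ {n} → List (Event n) → ℕ
  totalWeight = sum ∘ map (weight ∘ proj₁)

  totalWeight-++ : ∀ {n} (xs ys : List (Event n)) → totalWeight (xs ++ ys) ≡ totalWeight xs + totalWeight ys
  totalWeight-++ xs ys = trans (cong sum (map-++ (weight ∘ proj₁) xs ys)) (sum-++ (map (weight ∘ proj₁) xs) _)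

  -- What remains of an event on vertices 1 … n once vertex 0 has colour a.
  condition : ∀ {n} → Fin k → Event (suc n) → List (Event n)
  condition a (outside ∷ U , c) = [ U , c ]
  condition a (inside  ∷ U , c) = if does (c Fin.≟ a) then [ U , c ] else []

  conditionAll : ∀ {n} → Fin k → List (Event (suc n)) → List (Event n)
  conditionAll a = concatMap (condition a)

  ∑-totalWeight-condition : ∀ {n} (x : Event (suc n)) →
    ∑[ a < k ] totalWeight (condition a x) ≡ weight (proj₁ x)
  ∑-totalWeight-condition (outside ∷ U , c) = begin
    ∑[ a < k ] (weight U + 0) ≡⟨ ∑-const k _ ⟩
    k * (weight U + 0)        ≡⟨ cong (k *_) (+-identityʳ _) ⟩
    k * weight U              ∎
  ∑-totalWeight-condition (inside ∷ U , c) = begin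
    ∑[ a < k ] totalWeight (condition a (inside ∷ U , c))
      ≡⟨ sum-cong-≗ (λ a → weight-if (does (c Fin.≟ a))) ⟩
    ∑[ a < k ] (if does (c Fin.≟ a) then weight U else 0)
      ≡⟨ ∑-indicator c (weight U) ⟩
    weight U ∎
    where
    weight-if : ∀ b → totalWeight (if b then [ U , c ] else []) ≡ (if b then weight U else 0)
    weight-if true  = +-identityʳ (weight U)
    weight-if false = refl

  ∑-totalWeight-conditionAll : ∀ {n} (L : List (Event (suc n))) →
    ∑[ a < k ] totalWeight (conditionAll a L) ≡ totalWeight L
  ∑-totalWeight-conditionAll [] = trans (∑-const k 0) (*-zeroʳ k)
  ∑-totalWeight-conditionAll (x ∷ L) = begin
    ∑[ a < k ] totalWeight (condition a x ++ conditionAll a L)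
      ≡⟨ sum-cong-≗ (λ a → totalWeight-++ (condition a x) (conditionAll a L)) ⟩
    ∑[ a < k ] (totalWeight (condition a x) + totalWeight (conditionAll a L))
      ≡⟨ ∑-distrib-+ (λ a → totalWeight (condition a x)) _ ⟩
    ∑[ a < k ] totalWeight (condition a x) + ∑[ a < k ] totalWeight (conditionAll a L)
      ≡⟨ cong₂ _+_ (∑-totalWeight-condition x) (∑-totalWeight-conditionAll L) ⟩
    weight (proj₁ x) + totalWeight L ∎

  ¬Occurs-extend : ∀ {n} a (g : Vector (Fin k) n) (x : Event (suc n)) →
                   All (¬_ ∘ Occurs g) (condition a x) → ¬ Occurs (a Vector.∷ g) x
  ¬Occurs-extend a g (outside ∷ U , c) (¬occ ∷ []) occ = ¬occ (λ v v∈U → occ (suc v) (there v∈U))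
  ¬Occurs-extend a g (inside  ∷ U , c) ¬occs       occ with c Fin.≟ a | ¬occs
  ... | yes _   | ¬occ ∷ [] = ¬occ (λ v v∈U → occ (suc v) (there v∈U))
  ... | no  c≢a | _         = c≢a (sym (occ zero here))

  avoid : ∀ n (L : List (Event n)) → totalWeight L < k ^ n → ∃ λ g → All (¬_ ∘ Occurs g) L
  avoid zero    []              _ = (λ ()) , []
  avoid zero    (([] , _) ∷ _) (s≤s ())
  avoid (suc n) L w<k^n =
    let a , wₐ<k^n = ∑<*⇒∃< (λ a → totalWeight (conditionAll a L)) (k ^ n)
                       (subst (_< k ^ suc n) (sym (∑-totalWeight-conditionAll L)) w<k^n)
        g , ¬occs  = avoid n (conditionAll a L) wₐ<k^n
    in a Vector.∷ g , All.map (¬Occurs-extend a g _) (map⁻ (concat⁻ ¬occs))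

Unique∧All<⇒length≤ : ∀ k {xs : List ℕ} → Unique xs → All (_< k) xs → length xs ≤ k
Unique∧All<⇒length≤ k {xs} xs! xs<k with length xs ≤? k
... | yes |xs|≤k = |xs|≤k
... | no  |xs|≰k =
  let i , j , i<j , same =
        Finₚ.pigeonhole (≰⇒> |xs|≰k) (λ i → fromℕ< (All.lookup xs<k (∈-lookup {xs = xs} i)))
  in ⊥-elim (lookup-injective xs! i j i<j (fromℕ<-injective _ _ _ _ same))
  where
  lookup-injective : ∀ {ys : List ℕ} → Unique ys → ∀ i j → i Fin.< j → lookup ys i ≢ lookup ys j
  lookup-injective (y∉ys ∷ _)   zero    (suc j) _         = All.lookup y∉ys (∈-lookup j)
  lookup-injective (_    ∷ ys!) (suc i) (suc j) (s≤s i<j) = lookup-injective ys! i j i<j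

∈∧∈∧≢⇒2≤length : ∀ {x y : ℕ} xs → x ∈ˡ xs → y ∈ˡ xs → x ≢ y → 2 ≤ length xs
∈∧∈∧≢⇒2≤length (_ ∷ _)     (here refl) (here refl) x≢y = contradiction refl x≢y
∈∧∈∧≢⇒2≤length (_ ∷ _ ∷ _) (here _)    (there _)   _   = s≤s (s≤s z≤n)
∈∧∈∧≢⇒2≤length (_ ∷ _ ∷ _) (there _)   (here _)    _   = s≤s (s≤s z≤n)
∈∧∈∧≢⇒2≤length (_ ∷ xs)    (there x∈)  (there y∈)  x≢y =
  m≤n⇒m≤1+n (∈∧∈∧≢⇒2≤length xs x∈ y∈ x≢y)

module _ {n} (f : Vector ℕ n) (e : Subset n) where

  private
    colours : List ℕ
    colours = deduplicate _≟_ (map f (verticesOf e))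

  numColors≤ : ∀ k → (∀ v → f v < k) → numColors f e ≤ k
  numColors≤ k f<k = Unique∧All<⇒length≤ k (deduplicate-! _≟_ (map f (verticesOf e))) (All.tabulate colour<k)
    where
    colour<k : ∀ {x} → x ∈ˡ colours → x < k
    colour<k x∈ with ∈-map⁻ f (∈-deduplicate⁻ _≟_ (map f (verticesOf e)) x∈)
    ... | v , _ , refl = f<k v

  1<numColors : ∀ {u v} → u ∈ e → v ∈ e → f u ≢ f v → 1 < numColors f e
  1<numColors u∈e v∈e = ∈∧∈∧≢⇒2≤length colours (colour∈ u∈e) (colour∈ v∈e)
    where
    colour∈ : ∀ {v} → v ∈ e → f v ∈ˡ colours
    colour∈ v∈e = ∈-deduplicate⁺ _≟_ (∈-map⁺ f (∈-filter⁺ (_∈? e) (∈-allFin _) v∈e))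

0<∣p∣⇒Nonempty : ∀ {n} (p : Subset n) → 0 < ∣ p ∣ → Nonempty p
0<∣p∣⇒Nonempty {n} p 0<∣p∣ with nonempty? p
... | yes p≠∅ = p≠∅
... | no  p=∅ = contradiction (trans (cong ∣_∣ (Empty-unique p=∅)) (∣⊥∣≡0 n)) (>⇒≢ 0<∣p∣)

module _ (k : ℕ) where

  open MonochromaticAvoidance k

  monochromaticEvents : ∀ {n} → List (Subset n) → List (Event n)
  monochromaticEvents = concatMap (λ e → map (e ,_) (allFin k))

  totalWeight-map : ∀ {n} (e : Subset n) (cs : List (Fin k)) → totalWeight (map (e ,_) cs) ≡ length cs * weight e
  totalWeight-map e []       = refl
  totalWeight-map e (c ∷ cs) = cong (weight e +_) (totalWeight-map e cs)

  k^r*totalWeight-monochromaticEvents : ∀ {n} r (E : List (Subset n)) → Uniform r E →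
    k ^ r * totalWeight (monochromaticEvents E) ≡ length E * (k * k ^ n)
  k^r*totalWeight-monochromaticEvents r []      []          = *-zeroʳ (k ^ r)
  k^r*totalWeight-monochromaticEvents {n} r (e ∷ E) (∣e∣≡r ∷ uniform) = begin
    k ^ r * totalWeight (map (e ,_) (allFin k) ++ monochromaticEvents E)
      ≡⟨ cong (k ^ r *_) (totalWeight-++ (map (e ,_) (allFin k)) _) ⟩
    k ^ r * (totalWeight (map (e ,_) (allFin k)) + totalWeight (monochromaticEvents E))
      ≡⟨ *-distribˡ-+ (k ^ r) _ _ ⟩
    k ^ r * totalWeight (map (e ,_) (allFin k)) + k ^ r * totalWeight (monochromaticEvents E)
      ≡⟨ cong₂ _+_ edgeWeight (k^r*totalWeight-monochromaticEvents r E uniform) ⟩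
    k * k ^ n + length E * (k * k ^ n) ∎
    where
    edgeWeight : k ^ r * totalWeight (map (e ,_) (allFin k)) ≡ k * k ^ n
    edgeWeight = begin
      k ^ r * totalWeight (map (e ,_) (allFin k)) ≡⟨ cong (k ^ r *_) (totalWeight-map e (allFin k)) ⟩
      k ^ r * (length (allFin k) * weight e)     ≡⟨ cong (λ m → k ^ r * (m * weight e)) (length-tabulate {n = k} id) ⟩
      k ^ r * (k * weight e)                     ≡⟨ x∙yz≈y∙xz (k ^ r) k (weight e) ⟩
      k * (k ^ r * weight e)                     ≡⟨ cong (λ m → k * (k ^ m * weight e)) (sym ∣e∣≡r) ⟩
      k * (k ^ ∣ e ∣ * weight e)                 ≡⟨ cong (k *_) (k^∣U∣*weight≡k^n e) ⟩
      k * k ^ n                                  ∎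

  ¬Occurs⇒∃≢ : ∀ {n} (g : Vector (Fin k) n) {e c} → ¬ Occurs g (e , c) → ∃ λ u → u ∈ e × g u ≢ c
  ¬Occurs⇒∃≢ g {e} {c} ¬occ with Finₚ.any? (λ u → u ∈? e ×-dec ¬? (g u Fin.≟ c))
  ... | yes found = found
  ... | no  none  = contradiction occ ¬occ
    where
    occ : Occurs g (e , c)
    occ u u∈e = decidable-stable (g u Fin.≟ c) (λ gu≢c → none (u , u∈e , gu≢c))

  properOnEdge : ∀ {n} (g : Vector (Fin k) n) (e : Subset n) →
    ∣ e ∣ ≡ suc k → (∀ c → ¬ Occurs g (e , c)) →
    1 < numColors (toℕ ∘ g) e × numColors (toℕ ∘ g) e < ∣ e ∣
  properOnEdge g e ∣e∣≡1+k ¬mono =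
    let v , v∈e        = 0<∣p∣⇒Nonempty e (subst (0 <_) (sym ∣e∣≡1+k) (s≤s z≤n))
        u , u∈e , gu≢gv = ¬Occurs⇒∃≢ g (¬mono (g v))
    in 1<numColors (toℕ ∘ g) e u∈e v∈e (gu≢gv ∘ toℕ-injective) ,
       subst (numColors (toℕ ∘ g) e <_) (sym ∣e∣≡1+k) (s≤s (numColors≤ (toℕ ∘ g) e k (toℕ<n ∘ g)))

  ¬Occurs-monochromaticEvents : ∀ {n} (g : Vector (Fin k) n) (E : List (Subset n)) →
    All (¬_ ∘ Occurs g) (monochromaticEvents E) → All (λ e → ∀ c → ¬ Occurs g (e , c)) E
  ¬Occurs-monochromaticEvents g E ¬occs =
    All.map (λ ¬occs[e] c → All.lookup (map⁻ ¬occs[e]) (∈-allFin c)) (map⁻ (concat⁻ ¬occs))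

  |E|<k^k⇒Colorable : ∀ {n} .{{_ : NonZero k}} (E : List (Subset n)) → Uniform (suc k) E → length E < k ^ k →
    Colorable E
  |E|<k^k⇒Colorable {n} E uniform |E|<k^k =
    let g , ¬occs = avoid n (monochromaticEvents E) totalWeight<k^n
    in toℕ ∘ g , All.zipWith (λ (∣e∣≡1+k , ¬mono) → properOnEdge g _ ∣e∣≡1+k ¬mono)
                   (uniform , ¬Occurs-monochromaticEvents g E ¬occs)
    where
    instance
      k^1+n≢0 : NonZero (k * k ^ n)
      k^1+n≢0 = m^n≢0 k (suc n)
    k^k*k^1+n≡k^1+k*k^n : k ^ k * (k * k ^ n) ≡ k ^ suc k * k ^ n
    k^k*k^1+n≡k^1+k*k^n = trans (x∙yz≈y∙xz (k ^ k) k (k ^ n)) (sym (*-assoc k (k ^ k) (k ^ n)))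
    totalWeight<k^n : totalWeight (monochromaticEvents E) < k ^ n
    totalWeight<k^n = *-cancelˡ-< (k ^ suc k) _ _
      (subst₂ _<_ (sym (k^r*totalWeight-monochromaticEvents (suc k) E uniform)) k^k*k^1+n≡k^1+k*k^n
        (*-monoˡ-< (k * k ^ n) |E|<k^k))

corollary1p1 : (r : ℕ) → 3 ≤ r → (n : ℕ) → (E : List (Subset n)) →
    IsBiHypergraph E → Uniform r E → MinimalUncolorable E →
    (r ∸ 1) ^ (r ∸ 1) ≤ length E
corollary1p1 (suc (suc k)) (s≤s (s≤s _)) n E _ uniform (uncolorable , _) =
  ≮⇒≥ (uncolorable ∘ |E|<k^k⇒Colorable (suc k) E uniform)
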